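{- Let $T$ be a tree. For each integer $k\ge 0$, \[ \mathbf{\Gamma}_T^{(k)}(x,y)=\frac{y^{2k}}{k!}\cdot\frac{\partial^k\mathbf{G}_T}{\partial z^k}(x,y,y^2)\cdot \mathbf{G}_T(x,y,y^2)^{ -1}. \] In particular, $\mathbf{\Gamma}_T^{(k)}$ is determined by $\mathbf{G}_T$.
   Context: All graphs are finite and simple. For a tree $T$ and $A\subseteq V(T)$, $e(A)$ is the number of edges of $T$ with both endpoints in $A$ and $d(A)$ the number with exactly one endpoint in $A$; $\mathbf{G}_T(x,y,z)=\sum_{A\subseteq V(T)} x^{|A|}y^{d(A)}z^{e(A)}$. For $S\subseteq E(T)$, let $\overline{S}\subseteq V(T)$ be the set of vertices incident to at least one edge of $S$. Define $\mathbf{\Gamma}_T^{(0)}(x,y)=1$ and, for $k\ge 1$, \[ \mathbf{\Gamma}_T^{(k)}(x,y)=\sum_{S\subseteq E(T),\,|S|=k}\ \prod_{v\in\overline{S}}\frac{xy^{\deg(v)}}{1+xy^{\deg(v)}}\in\mathbb{Q}(x,y). \] -}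

module Defs where

open import Data.Bool using (Bool; true; false; if_then_else_; _∧_; _∨_; not; _xor_)
open import Data.Nat as ℕ using (ℕ; zero; suc; _∸_; _≤_; _<ᵇ_)
open import Data.Fin using (Fin; toℕ)
open import Data.Fin.Subset using (Subset; ∣_∣)
open import Data.Vec using (Vec; []; _∷_; lookup)
open import Data.List as List using (List; []; _∷_; _++_; [_]; allFin; filterᵇ; length; concatMap)
open import Data.List.Relation.Unary.Unique.Propositional using (Unique)
open import Data.Product using (_×_; _,_; Σ; proj₁; proj₂)
open import Data.Rational using (ℚ; 0ℚ; 1ℚ; _+_; _*_; 1/_; ≢-nonZero)
open import Data.Rational.Properties using (_≟_)
open import Relation.Binary.PropositionalEquality using (_≡_)
open import Relation.Nullary using (¬_; yes; no)
open import Relation.Nullary.Decidable using (does)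
open import Data.Empty using (⊥)

record Graph (n : ℕ) : Set where
  field
    adj     : Fin n → Fin n → Bool
    adj-sym : ∀ u v → adj u v ≡ adj v u
    irrefl  : ∀ v → adj v v ≡ false
open Graph public

data Walk {n : ℕ} (G : Graph n) : Fin n → Fin n → Set where
  here : ∀ {v} → Walk G v v
  step : ∀ {u w v} → adj G u w ≡ true → Walk G w v → Walk G u v

Chain : ∀ {n} → Graph n → List (Fin n) → Set
Chain G []           = Data.Unit.⊤ where import Data.Unit
Chain G (u ∷ [])     = Data.Unit.⊤ where import Data.Unit
Chain G (u ∷ w ∷ vs) = (adj G u w ≡ true) × Chain G (w ∷ vs)

record Cycle {n : ℕ} (G : Graph n) : Set where
  field
    start   : Fin n
    rest    : List (Fin n)
    long    : 3 ≤ length (start ∷ rest)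
    distinct : Unique (start ∷ rest)
    closed  : Chain G ((start ∷ rest) ++ [ start ])

record IsTree {n : ℕ} (G : Graph n) : Set where
  field
    nonempty  : 1 ≤ n
    connected : ∀ u v → Walk G u v
    acyclic   : ¬ Cycle G

count : ∀ {a} {A : Set a} → (A → Bool) → List A → ℕ
count p xs = length (filterᵇ p xs)

deg : ∀ {n} → Graph n → Fin n → ℕ
deg G v = count (adj G v) (allFin _)

-- the edge set E(G): pairs (i , j) with i < j and i ~ j (each edge once)
edges : ∀ {n} → Graph n → List (Fin n × Fin n)
edges {n} G = filterᵇ (λ e → (toℕ (proj₁ e) <ᵇ toℕ (proj₂ e)) ∧ adj G (proj₁ e) (proj₂ e))
                     (concatMap (λ i → List.map (λ j → (i , j)) (allFin n)) (allFin n))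

subsets : (n : ℕ) → List (Subset n)
subsets zero    = [] ∷ []
subsets (suc n) = List.map (true ∷_) (subsets n) ++ List.map (false ∷_) (subsets n)

-- all k-element sub-lists (= k-subsets, since edges has no repetitions)
choose : ∀ {a} {A : Set a} → ℕ → List A → List (List A)
choose zero    xs       = [] ∷ []
choose (suc k) []       = []
choose (suc k) (x ∷ xs) = List.map (x ∷_) (choose k xs) ++ choose (suc k) xs

eIn : ∀ {n} → Graph n → Subset n → ℕ
eIn G A = count (λ e → lookup A (proj₁ e) ∧ lookup A (proj₂ e)) (edges G)

dOut : ∀ {n} → Graph n → Subset n → ℕ
dOut G A = count (λ e → lookup A (proj₁ e) xor lookup A (proj₂ e)) (edges G)

infixr 8 _^_
_^_ : ℚ → ℕ → ℚ
p ^ zero  = 1ℚ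
p ^ suc k = p * (p ^ k)

fromℕ : ℕ → ℚ
fromℕ k = Data.Integer.+ k Data.Rational./ 1
  where import Data.Integer ; import Data.Rational

-- total inverse (inv 0 = 0); only ever used at non-zero arguments below
inv : ℚ → ℚ
inv p with p ≟ 0ℚ
... | yes _  = 0ℚ
... | no p≢0 = 1/_ p {{≢-nonZero p≢0}}

sumℚ : List ℚ → ℚ
sumℚ = List.foldr _+_ 0ℚ

prodℚ : List ℚ → ℚ
prodℚ = List.foldr _*_ 1ℚ

-- G_T as a formal polynomial in x, y, z:  Σ_A x^|A| y^d(A) z^e(A)

record Monomial : Set where
  constructor mono
  field
    coeff : ℕ
    ex ey ez : ℕ

Poly : Set
Poly = List Monomial

GPoly : ∀ {n} → Graph n → Poly
GPoly {n} T = List.map (λ A → mono 1 ∣ A ∣ (dOut T A) (eIn T A)) (subsets n)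

∂z : Poly → Poly
∂z = List.map (λ { (mono c a b e) → mono (c ℕ.* e) a b (e ∸ 1) })

∂z^ : ℕ → Poly → Poly
∂z^ zero    P = P
∂z^ (suc k) P = ∂z (∂z^ k P)

evalPoly : Poly → ℚ → ℚ → ℚ → ℚ
evalPoly P x y z = sumℚ (List.map (λ { (mono c a b e) → fromℕ c * x ^ a * y ^ b * z ^ e }) P)

coveredBy : ∀ {n} → List (Fin n × Fin n) → List (Fin n)
coveredBy {n} S = filterᵇ (λ v → List.foldr _∨_ false (List.map (λ e → does (proj₁ e Data.Fin.≟ v) ∨ does (proj₂ e Data.Fin.≟ v)) S))
                  (allFin n)
  where import Data.Fin

Γ : ∀ {n} → Graph n → ℕ → ℚ → ℚ → ℚ
Γ T k x y = sumℚ (List.map (λ S → prodℚ (List.map (λ v → (x * y ^ deg T v) * inv (1ℚ + x * y ^ deg T v)) (coveredBy S)))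
                            (choose k (edges T)))

-- Write w v = x y^(deg v). At z = y² the monomial x^|A| y^d(A) z^e(A) of a vertex set A becomes
-- x^|A| y^(d(A) + 2 e(A)) = ∏_{v ∈ A} w v, because d(A) + 2 e(A) = Σ_{v ∈ A} deg v (handshake);
-- summing over A gives G_T(x, y, y²) = ∏_v (1 + w v). Differentiating k times in z and rescaling
-- by y^(2k) / k! turns the monomial of A into C(e(A), k) ∏_{v ∈ A} w v, and C(e(A), k) counts the
-- k-sets S of edges with V(S) ⊆ A. Exchanging the two sums, the supersets A of V(S) contribute
-- ∏_{v ∈ V(S)} w v · ∏_{v ∉ V(S)} (1 + w v), which divided by G_T(x, y, y²) is the term of S in Γ_T^(k).

module Submission where

open import Defs
open import Data.Nat using (ℕ)
open import Data.Nat using (_!)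
open import Data.Fin using (Fin)
open import Relation.Binary.PropositionalEquality using (_≡_; _≢_)

open import Algebra.Bundles using (CommutativeSemiring; CommutativeRing)
import Algebra.Properties.CommutativeSemigroup as CommutativeSemigroupProperties
open import Data.Bool using (Bool; true; false; if_then_else_; not; _∧_; _∨_; _xor_; T)
open import Data.Bool.ListAction using (all; any)
open import Data.Bool.Properties using (T-∧; T-∨)
open import Data.Empty using (⊥-elim)
open import Data.Fin using (zero; suc; toℕ; _≟_)
open import Data.Fin.Properties using (toℕ-injective)
open import Data.Fin.Subset using (Subset; ∣_∣)
open import Data.Maybe using (nothing)
open import Data.Nat.Combinatorics using (_C_; k>n⇒nCk≡0)
open import Data.Nat.Combinatorics.Base using (_P′_)
open import Data.List using (List; []; _∷_; _++_; map; foldr; filterᵇ; concatMap; allFin)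
open import Data.List.Membership.Propositional using (_∈_)
open import Data.List.Membership.Propositional.Properties using (∈-allFin)
open import Data.List.Properties using (map-∘; map-tabulate; map-cong; map-id)
import Data.List.Relation.Unary.All as All
open import Data.List.Relation.Unary.All.Properties using (all⁺; all⁻)
import Data.List.Relation.Unary.Any as Any
open import Data.List.Relation.Unary.Any.Properties using (any⁺; any⁻)
import Data.Nat as ℕ
import Data.Nat.Properties as ℕ
open import Data.Product using (_×_; _,_; proj₁; proj₂)
open import Data.Sum using (inj₁; inj₂)
open import Data.Unit using (tt)
open import Data.Vec using ([]; _∷_; lookup)
open import Function using (_∘_; id; mk⇔; Equivalence)
open import Level using (0ℓ)
open import Relation.Binary.PropositionalEquality
  using (refl; sym; trans; cong; cong₂; subst; module ≡-Reasoning)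
import Relation.Binary.PropositionalEquality as ≡
open import Relation.Binary.Bundles using (Setoid)
open import Relation.Nullary using (yes; no)
open import Relation.Nullary.Decidable using (does; does-⇔; dec-true; T?)
open import Relation.Nullary.Reflects using (ofʸ; ofⁿ)

module BigOperators {c ℓ} (R : CommutativeSemiring c ℓ) where

  open CommutativeSemiring R
    using (Carrier; _≈_; _+_; _*_; 0#; 1#; setoid; +-cong; +-congˡ; +-congʳ; *-cong; *-congˡ; *-congʳ;
           +-assoc; +-comm; +-identityˡ; +-identityʳ; *-identityˡ; distribˡ; distribʳ; zeroˡ; zeroʳ;
           +-commutativeSemigroup; *-commutativeSemigroup)
  open import Relation.Binary.Reasoning.Setoid setoid
  private module ≈ = Setoid setoid
  open CommutativeSemigroupProperties +-commutativeSemigroup using () renaming (interchange to +-interchange)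
  open CommutativeSemigroupProperties *-commutativeSemigroup using (x∙yz≈y∙xz) renaming (interchange to *-interchange)

  ∑ ∏ : {X : Set} → List X → (X → Carrier) → Carrier
  ∑ xs f = foldr _+_ 0# (map f xs)
  ∏ xs f = foldr _*_ 1# (map f xs)

  𝟙 : Bool → Carrier
  𝟙 b = if b then 1# else 0#

  weight : ∀ {n} → (Fin n → Carrier) → Subset n → Carrier
  weight {n} w A = ∏ (allFin n) (λ v → if lookup A v then w v else 1#)

  module _ {X : Set} where

    ∑-cong : ∀ xs {f g : X → Carrier} → (∀ x → f x ≈ g x) → ∑ xs f ≈ ∑ xs g
    ∑-cong []       f≈g = ≈.refl
    ∑-cong (x ∷ xs) f≈g = +-cong (f≈g x) (∑-cong xs f≈g)

    ∏-cong : ∀ xs {f g : X → Carrier} → (∀ x → f x ≈ g x) → ∏ xs f ≈ ∏ xs g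
    ∏-cong []       f≈g = ≈.refl
    ∏-cong (x ∷ xs) f≈g = *-cong (f≈g x) (∏-cong xs f≈g)

    ∑-++ : ∀ xs ys (f : X → Carrier) → ∑ (xs ++ ys) f ≈ ∑ xs f + ∑ ys f
    ∑-++ []       ys f = ≈.sym (+-identityˡ _)
    ∑-++ (x ∷ xs) ys f = ≈.trans (+-congˡ (∑-++ xs ys f)) (≈.sym (+-assoc _ _ _))

    ∑-zero : ∀ (xs : List X) → ∑ xs (λ _ → 0#) ≈ 0#
    ∑-zero []       = ≈.refl
    ∑-zero (x ∷ xs) = ≈.trans (+-identityˡ _) (∑-zero xs)

    ∑-distrib-+ : ∀ xs (f g : X → Carrier) → ∑ xs (λ x → f x + g x) ≈ ∑ xs f + ∑ xs g
    ∑-distrib-+ []       f g = ≈.sym (+-identityˡ 0#)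
    ∑-distrib-+ (x ∷ xs) f g = ≈.trans (+-congˡ (∑-distrib-+ xs f g)) (+-interchange (f x) (g x) _ _)

    *-distribˡ-∑ : ∀ c xs (f : X → Carrier) → c * ∑ xs f ≈ ∑ xs (λ x → c * f x)
    *-distribˡ-∑ c []       f = zeroʳ c
    *-distribˡ-∑ c (x ∷ xs) f = ≈.trans (distribˡ c (f x) _) (+-congˡ (*-distribˡ-∑ c xs f))

    *-distribʳ-∑ : ∀ c xs (f : X → Carrier) → ∑ xs f * c ≈ ∑ xs (λ x → f x * c)
    *-distribʳ-∑ c []       f = zeroˡ c
    *-distribʳ-∑ c (x ∷ xs) f = ≈.trans (distribʳ c (f x) _) (+-congˡ (*-distribʳ-∑ c xs f))

    ∑-filterᵇ : ∀ (p : X → Bool) xs f → ∑ (filterᵇ p xs) f ≈ ∑ xs (λ x → 𝟙 (p x) * f x)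
    ∑-filterᵇ p []       f = ≈.refl
    ∑-filterᵇ p (x ∷ xs) f with p x
    ... | true  = +-cong (≈.sym (*-identityˡ (f x))) (∑-filterᵇ p xs f)
    ... | false = ≈.trans (∑-filterᵇ p xs f) (≈.sym (≈.trans (+-congʳ (zeroˡ (f x))) (+-identityˡ _)))

    ∏-filterᵇ : ∀ (p : X → Bool) xs f → ∏ (filterᵇ p xs) f ≈ ∏ xs (λ x → if p x then f x else 1#)
    ∏-filterᵇ p []       f = ≈.refl
    ∏-filterᵇ p (x ∷ xs) f with p x
    ... | true  = *-congˡ (∏-filterᵇ p xs f)
    ... | false = ≈.trans (∏-filterᵇ p xs f) (≈.sym (*-identityˡ _))

    ∏-distrib-* : ∀ xs (f g : X → Carrier) → ∏ xs f * ∏ xs g ≈ ∏ xs (λ x → f x * g x)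
    ∏-distrib-* []       f g = *-identityˡ 1#
    ∏-distrib-* (x ∷ xs) f g = ≈.trans (*-interchange (f x) _ (g x) _) (*-congˡ (∏-distrib-* xs f g))

    𝟙-all-* : ∀ (p : X → Bool) xs f → 𝟙 (all p xs) * ∏ xs f ≈ ∏ xs (λ x → 𝟙 (p x) * f x)
    𝟙-all-* p []       f = *-identityˡ 1#
    𝟙-all-* p (x ∷ xs) f with p x
    ... | false = ≈.trans (zeroˡ _) (≈.sym (≈.trans (*-congʳ (zeroˡ (f x))) (zeroˡ _)))
    ... | true  = begin
      𝟙 (all p xs) * (f x * ∏ xs f)           ≈⟨ x∙yz≈y∙xz _ (f x) _ ⟩
      f x * (𝟙 (all p xs) * ∏ xs f)           ≈⟨ *-cong (≈.sym (*-identityˡ (f x))) (𝟙-all-* p xs f) ⟩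
      1# * f x * ∏ xs (λ x → 𝟙 (p x) * f x)   ∎

  module _ {X Y : Set} where

    ∑-map : ∀ (g : X → Y) xs (f : Y → Carrier) → ∑ (map g xs) f ≈ ∑ xs (f ∘ g)
    ∑-map g xs f = ≈.reflexive (≡.cong (foldr _+_ 0#) (≡.sym (map-∘ xs)))

    ∑-concatMap : ∀ (g : X → List Y) xs (f : Y → Carrier) → ∑ (concatMap g xs) f ≈ ∑ xs (λ x → ∑ (g x) f)
    ∑-concatMap g []       f = ≈.refl
    ∑-concatMap g (x ∷ xs) f = ≈.trans (∑-++ (g x) _ f) (+-congˡ (∑-concatMap g xs f))

    ∑-comm : ∀ xs ys (f : X → Y → Carrier) → ∑ xs (λ x → ∑ ys (f x)) ≈ ∑ ys (λ y → ∑ xs (λ x → f x y))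
    ∑-comm []       ys f = ≈.sym (∑-zero ys)
    ∑-comm (x ∷ xs) ys f = ≈.trans (+-congˡ (∑-comm xs ys f)) (≈.sym (∑-distrib-+ ys (f x) _))

  ∑-allFin-suc : ∀ {n} (f : Fin (ℕ.suc n) → Carrier) → ∑ (allFin (ℕ.suc n)) f ≈ f zero + ∑ (allFin n) (f ∘ suc)
  ∑-allFin-suc {n} f = ≈.reflexive (≡.cong (λ ys → f zero + foldr _+_ 0# ys)
    (≡.trans (map-tabulate suc f) (≡.sym (map-tabulate id (f ∘ suc)))))

  ∏-allFin-suc : ∀ {n} (f : Fin (ℕ.suc n) → Carrier) → ∏ (allFin (ℕ.suc n)) f ≈ f zero * ∏ (allFin n) (f ∘ suc)
  ∏-allFin-suc {n} f = ≈.reflexive (≡.cong (λ ys → f zero * foldr _*_ 1# ys)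
    (≡.trans (map-tabulate suc f) (≡.sym (map-tabulate id (f ∘ suc)))))

  ∑-subsets-∏ : ∀ n (f : Fin n → Bool → Carrier) →
    ∑ (subsets n) (λ A → ∏ (allFin n) (λ v → f v (lookup A v))) ≈ ∏ (allFin n) (λ v → f v true + f v false)
  ∑-subsets-∏ ℕ.zero    f = +-identityʳ 1#
  ∑-subsets-∏ (ℕ.suc n) f = begin
    ∑ (map (true ∷_) S ++ map (false ∷_) S) F                       ≈⟨ ∑-++ (map (true ∷_) S) _ F ⟩
    ∑ (map (true ∷_) S) F + ∑ (map (false ∷_) S) F                  ≈⟨ +-cong (∑-map (true ∷_) S F) (∑-map (false ∷_) S F) ⟩
    ∑ S (F ∘ (true ∷_)) + ∑ S (F ∘ (false ∷_))                      ≈⟨ +-cong (∑-cong S (∏-allFin-suc ∘ F₁)) (∑-cong S (∏-allFin-suc ∘ F₀)) ⟩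
    ∑ S (λ A → f zero true * P A) + ∑ S (λ A → f zero false * P A)  ≈⟨ +-cong (*-distribˡ-∑ _ S P) (*-distribˡ-∑ _ S P) ⟨
    f zero true * ∑ S P + f zero false * ∑ S P                      ≈⟨ distribʳ _ _ _ ⟨
    (f zero true + f zero false) * ∑ S P                            ≈⟨ *-congˡ (∑-subsets-∏ n (f ∘ suc)) ⟩
    (f zero true + f zero false) * ∏ (allFin n) (λ v → f (suc v) true + f (suc v) false)
                                                                    ≈⟨ ∏-allFin-suc (λ v → f v true + f v false) ⟨
    ∏ (allFin (ℕ.suc n)) (λ v → f v true + f v false)               ∎
    where
    S : List (Subset n)
    S = subsets n
    F : Subset (ℕ.suc n) → Carrier
    F A = ∏ (allFin (ℕ.suc n)) (λ v → f v (lookup A v))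
    F₁ F₀ : Subset n → Fin (ℕ.suc n) → Carrier
    F₁ A v = f v (lookup (true ∷ A) v)
    F₀ A v = f v (lookup (false ∷ A) v)
    P : Subset n → Carrier
    P A = ∏ (allFin n) (λ v → f (suc v) (lookup A v))

  ∑-supersets-weight : ∀ n (B : Fin n → Bool) (w : Fin n → Carrier) →
    ∑ (subsets n) (λ A → 𝟙 (all (λ v → not (B v) ∨ lookup A v) (allFin n)) * weight w A)
      ≈ ∏ (allFin n) (λ v → if B v then w v else 1# + w v)
  ∑-supersets-weight n B w = begin
    ∑ (subsets n) (λ A → 𝟙 (all (λ v → not (B v) ∨ lookup A v) (allFin n)) * weight w A)
      ≈⟨ ∑-cong (subsets n) (λ A → 𝟙-all-* (λ v → not (B v) ∨ lookup A v) (allFin n) _) ⟩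
    ∑ (subsets n) (λ A → ∏ (allFin n) (λ v → f v (lookup A v)))
      ≈⟨ ∑-subsets-∏ n f ⟩
    ∏ (allFin n) (λ v → f v true + f v false)
      ≈⟨ ∏-cong (allFin n) (λ v → vertex-factor (B v) (w v)) ⟩
    ∏ (allFin n) (λ v → if B v then w v else 1# + w v) ∎
    where
    f : Fin n → Bool → Carrier
    f v b = 𝟙 (not (B v) ∨ b) * (if b then w v else 1#)
    vertex-factor : ∀ c p → 𝟙 (not c ∨ true) * p + 𝟙 (not c ∨ false) * 1# ≈ (if c then p else 1# + p)
    vertex-factor true  p = ≈.trans (+-cong (*-identityˡ p) (zeroˡ 1#)) (+-identityʳ p)
    vertex-factor false p = ≈.trans (+-cong (*-identityˡ p) (*-identityˡ 1#)) (+-comm p 1#)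

-- Counting: binomial coefficients and the handshake lemma

module Sumℕ = BigOperators ℕ.+-*-commutativeSemiring

module _ where

  open import Data.Nat using (_+_; _*_; _∸_; _<_; _<ᵇ_; s≤s)
  open import Data.Nat.Properties using (<ᵇ-reflects-<; <-asym; ≤-antisym; ≮⇒≥)
  open import Data.Nat.Combinatorics using (nCk≡nPk/k!; nCk+nC[k+1]≡[n+1]C[k+1])
  open import Data.Nat.Combinatorics.Specification using (nPk≡n!/[n∸k]!; nP′k≡n!/[n∸k]!; k!∣nP′k)
  open import Data.Nat.DivMod using (m/n*n≡m)
  open Sumℕ

  count≡∑𝟙 : ∀ {X : Set} (p : X → Bool) xs → count p xs ≡ ∑ xs (𝟙 ∘ p)
  count≡∑𝟙 p []       = refl
  count≡∑𝟙 p (x ∷ xs) with p x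
  ... | true  = cong ℕ.suc (count≡∑𝟙 p xs)
  ... | false = count≡∑𝟙 p xs

  ∑-choose-all : ∀ {X : Set} (p : X → Bool) k xs → ∑ (choose k xs) (𝟙 ∘ all p) ≡ count p xs C k
  ∑-choose-all p ℕ.zero    xs       = refl
  ∑-choose-all p (ℕ.suc k) []       = refl
  ∑-choose-all p (ℕ.suc k) (x ∷ xs) = begin
    ∑ (map (x ∷_) (choose k xs) ++ choose (ℕ.suc k) xs) (𝟙 ∘ all p)
      ≡⟨ ∑-++ (map (x ∷_) (choose k xs)) _ _ ⟩
    ∑ (map (x ∷_) (choose k xs)) (𝟙 ∘ all p) + ∑ (choose (ℕ.suc k) xs) (𝟙 ∘ all p)
      ≡⟨ cong₂ _+_ (∑-map (x ∷_) (choose k xs) _) (∑-choose-all p (ℕ.suc k) xs) ⟩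
    ∑ (choose k xs) (λ S → 𝟙 (p x ∧ all p S)) + count p xs C ℕ.suc k
      ≡⟨ pascal ⟩
    count p (x ∷ xs) C ℕ.suc k ∎
    where
    open ≡-Reasoning
    pascal : ∑ (choose k xs) (λ S → 𝟙 (p x ∧ all p S)) + count p xs C ℕ.suc k ≡ count p (x ∷ xs) C ℕ.suc k
    pascal with p x
    ... | true  = trans (cong (_+ count p xs C ℕ.suc k) (∑-choose-all p k xs)) (nCk+nC[k+1]≡[n+1]C[k+1] _ k)
    ... | false = cong (_+ count p xs C ℕ.suc k) (∑-zero (choose k xs))

  k>n⇒nP′k≡0 : ∀ {n k} → n < k → n P′ k ≡ 0
  k>n⇒nP′k≡0 {n} {ℕ.suc k} (s≤s n≤k) with ℕ.m≤n⇒m<n∨m≡n n≤k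
  ... | inj₁ n<k  = trans (cong ((n ∸ k) *_) (k>n⇒nP′k≡0 n<k)) (ℕ.*-zeroʳ (n ∸ k))
  ... | inj₂ refl = cong (_* (n P′ n)) (ℕ.n∸n≡0 n)

  nP′k≡nCk*k! : ∀ n k → n P′ k ≡ (n C k) * k !
  nP′k≡nCk*k! n k with k ℕ.≤? n
  ... | yes k≤n = sym (begin
    (n C k) * k !        ≡⟨ cong (_* k !) (nCk≡nPk/k! k≤n) ⟩
    (n P k) / k ! * k !  ≡⟨ cong (λ m → m / k ! * k !) (trans (nPk≡n!/[n∸k]! k≤n) (sym (nP′k≡n!/[n∸k]! k≤n))) ⟩
    (n P′ k) / k ! * k ! ≡⟨ m/n*n≡m (k!∣nP′k k≤n) ⟩
    n P′ k               ∎)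
    where
    open ≡-Reasoning
    open import Data.Nat.Combinatorics using (_P_)
    open import Data.Nat using (_/_)
    instance
      k!≢0 : ℕ.NonZero (k !)
      k!≢0 = ℕ._!≢0 k
  ... | no k≰n rewrite k>n⇒nCk≡0 (ℕ.≰⇒> k≰n) = k>n⇒nP′k≡0 (ℕ.≰⇒> k≰n)

  𝟙-xor+2*𝟙-∧ : ∀ a b → 𝟙 (a xor b) + 2 * 𝟙 (a ∧ b) ≡ 𝟙 a + 𝟙 b
  𝟙-xor+2*𝟙-∧ true  true  = refl
  𝟙-xor+2*𝟙-∧ true  false = refl
  𝟙-xor+2*𝟙-∧ false true  = refl
  𝟙-xor+2*𝟙-∧ false false = refl

  module _ {n : ℕ} (G : Graph n) where

    𝟙-edge : Fin n → Fin n → ℕ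
    𝟙-edge i j = 𝟙 ((toℕ i <ᵇ toℕ j) ∧ adj G i j)

    ∑-edges : ∀ (h : Fin n × Fin n → ℕ) → ∑ (edges G) h ≡ ∑ (allFin n) (λ i → ∑ (allFin n) (λ j → 𝟙-edge i j * h (i , j)))
    ∑-edges h = begin
      ∑ (edges G) h
        ≡⟨ ∑-filterᵇ _ (concatMap (λ i → map (i ,_) (allFin n)) (allFin n)) h ⟩
      ∑ (concatMap (λ i → map (i ,_) (allFin n)) (allFin n)) (λ e → 𝟙-edge (proj₁ e) (proj₂ e) * h e)
        ≡⟨ ∑-concatMap (λ i → map (i ,_) (allFin n)) (allFin n) _ ⟩
      ∑ (allFin n) (λ i → ∑ (map (i ,_) (allFin n)) (λ e → 𝟙-edge (proj₁ e) (proj₂ e) * h e))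
        ≡⟨ ∑-cong (allFin n) (λ i → ∑-map (i ,_) (allFin n) _) ⟩
      ∑ (allFin n) (λ i → ∑ (allFin n) (λ j → 𝟙-edge i j * h (i , j))) ∎
      where open ≡-Reasoning

    𝟙-adj≡𝟙-edge+𝟙-edge : ∀ i j → 𝟙 (adj G i j) ≡ 𝟙-edge i j + 𝟙-edge j i
    𝟙-adj≡𝟙-edge+𝟙-edge i j rewrite adj-sym G j i
      with toℕ i <ᵇ toℕ j | <ᵇ-reflects-< (toℕ i) (toℕ j) | toℕ j <ᵇ toℕ i | <ᵇ-reflects-< (toℕ j) (toℕ i)
    ... | true  | ofʸ i<j | true  | ofʸ j<i = ⊥-elim (<-asym i<j j<i)
    ... | true  | _       | false | _       = sym (ℕ.+-identityʳ _)
    ... | false | _       | true  | _       = refl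
    ... | false | ofⁿ i≮j | false | ofⁿ j≮i with toℕ-injective (≤-antisym (≮⇒≥ j≮i) (≮⇒≥ i≮j))
    ... | refl rewrite irrefl G i = refl

    deg≡∑𝟙-edge+∑𝟙-edge : ∀ i → deg G i ≡ ∑ (allFin n) (𝟙-edge i) + ∑ (allFin n) (λ j → 𝟙-edge j i)
    deg≡∑𝟙-edge+∑𝟙-edge i = begin
      deg G i                                          ≡⟨ count≡∑𝟙 (adj G i) (allFin n) ⟩
      ∑ (allFin n) (𝟙 ∘ adj G i)                       ≡⟨ ∑-cong (allFin n) (𝟙-adj≡𝟙-edge+𝟙-edge i) ⟩
      ∑ (allFin n) (λ j → 𝟙-edge i j + 𝟙-edge j i)               ≡⟨ ∑-distrib-+ (allFin n) (𝟙-edge i) _ ⟩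
      ∑ (allFin n) (𝟙-edge i) + ∑ (allFin n) (λ j → 𝟙-edge j i)  ∎
      where open ≡-Reasoning

    handshake : ∀ (f : Fin n → ℕ) → ∑ (edges G) (λ e → f (proj₁ e) + f (proj₂ e)) ≡ ∑ (allFin n) (λ v → deg G v * f v)
    handshake f = begin
      ∑ (edges G) (λ e → f (proj₁ e) + f (proj₂ e))
        ≡⟨ ∑-edges _ ⟩
      ∑ V (λ i → ∑ V (λ j → 𝟙-edge i j * (f i + f j)))
        ≡⟨ ∑-cong V (λ i → trans (∑-cong V (λ j → ℕ.*-distribˡ-+ (𝟙-edge i j) (f i) (f j))) (∑-distrib-+ V _ _)) ⟩
      ∑ V (λ i → ∑ V (λ j → 𝟙-edge i j * f i) + ∑ V (λ j → 𝟙-edge i j * f j))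
        ≡⟨ ∑-distrib-+ V _ _ ⟩
      ∑ V (λ i → ∑ V (λ j → 𝟙-edge i j * f i)) + ∑ V (λ i → ∑ V (λ j → 𝟙-edge i j * f j))
        ≡⟨ cong (∑ V (λ i → ∑ V (λ j → 𝟙-edge i j * f i)) +_) (∑-comm V V (λ i j → 𝟙-edge i j * f j)) ⟩
      ∑ V (λ i → ∑ V (λ j → 𝟙-edge i j * f i)) + ∑ V (λ i → ∑ V (λ j → 𝟙-edge j i * f i))
        ≡⟨ sym (∑-distrib-+ V _ _) ⟩
      ∑ V (λ i → ∑ V (λ j → 𝟙-edge i j * f i) + ∑ V (λ j → 𝟙-edge j i * f i))
        ≡⟨ ∑-cong V (λ i → cong₂ _+_ (sym (*-distribʳ-∑ (f i) V (𝟙-edge i))) (sym (*-distribʳ-∑ (f i) V (λ j → 𝟙-edge j i)))) ⟩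
      ∑ V (λ i → ∑ V (𝟙-edge i) * f i + ∑ V (λ j → 𝟙-edge j i) * f i)
        ≡⟨ ∑-cong V (λ i → trans (sym (ℕ.*-distribʳ-+ (f i) (∑ V (𝟙-edge i)) (∑ V (λ j → 𝟙-edge j i)))) (cong (_* f i) (sym (deg≡∑𝟙-edge+∑𝟙-edge i)))) ⟩
      ∑ V (λ v → deg G v * f v) ∎
      where
      open ≡-Reasoning
      V : List (Fin n)
      V = allFin n

    dOut+2*eIn≡∑deg : ∀ A → dOut G A + 2 * eIn G A ≡ ∑ (allFin n) (λ v → deg G v * 𝟙 (lookup A v))
    dOut+2*eIn≡∑deg A = begin
      dOut G A + 2 * eIn G A
        ≡⟨ cong₂ (λ d e → d + 2 * e) (count≡∑𝟙 _ (edges G)) (count≡∑𝟙 _ (edges G)) ⟩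
      ∑ (edges G) (λ e → 𝟙 (a e xor b e)) + 2 * ∑ (edges G) (λ e → 𝟙 (a e ∧ b e))
        ≡⟨ cong (∑ (edges G) (λ e → 𝟙 (a e xor b e)) +_) (*-distribˡ-∑ 2 (edges G) _) ⟩
      ∑ (edges G) (λ e → 𝟙 (a e xor b e)) + ∑ (edges G) (λ e → 2 * 𝟙 (a e ∧ b e))
        ≡⟨ sym (∑-distrib-+ (edges G) _ _) ⟩
      ∑ (edges G) (λ e → 𝟙 (a e xor b e) + 2 * 𝟙 (a e ∧ b e))
        ≡⟨ ∑-cong (edges G) (λ e → 𝟙-xor+2*𝟙-∧ (a e) (b e)) ⟩
      ∑ (edges G) (λ e → 𝟙 (a e) + 𝟙 (b e))
        ≡⟨ handshake (𝟙 ∘ lookup A) ⟩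
      ∑ (allFin n) (λ v → deg G v * 𝟙 (lookup A v)) ∎
      where
      open ≡-Reasoning
      a b : Fin n × Fin n → Bool
      a e = lookup A (proj₁ e)
      b e = lookup A (proj₂ e)

-- Edge sets and the vertices they cover

T-not∨⁺ : ∀ {c b} → (T c → T b) → T (not c ∨ b)
T-not∨⁺ {true}  c⇒b = c⇒b tt
T-not∨⁺ {false} c⇒b = tt

T-not∨⁻ : ∀ {c b} → T (not c ∨ b) → T c → T b
T-not∨⁻ {true} b _ = b

bothIn : ∀ {n} → Subset n → Fin n × Fin n → Bool
bothIn A e = lookup A (proj₁ e) ∧ lookup A (proj₂ e)

touches : ∀ {n} → Fin n × Fin n → Fin n → Bool
touches e v = does (proj₁ e ≟ v) ∨ does (proj₂ e ≟ v)

-- coveredBy S is filterᵇ (covers S) (allFin n) by definition.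
covers : ∀ {n} → List (Fin n × Fin n) → Fin n → Bool
covers S v = any (λ e → touches e v) S

module _ {n : ℕ} where

  touches-proj₁ : ∀ (e : Fin n × Fin n) → T (touches e (proj₁ e))
  touches-proj₁ (u , _) rewrite dec-true (u ≟ u) refl = tt

  touches-proj₂ : ∀ (e : Fin n × Fin n) → T (touches e (proj₂ e))
  touches-proj₂ (_ , v) rewrite dec-true (v ≟ v) refl = Equivalence.from T-∨ (inj₂ tt)

  touches⇒∈ : ∀ (A : Subset n) e v → T (bothIn A e) → T (touches e v) → T (lookup A v)
  touches⇒∈ A (u₁ , u₂) v both touch with u₁ ≟ v | u₂ ≟ v
  ... | yes refl | _        = proj₁ (Equivalence.to T-∧ both)
  ... | no _     | yes refl = proj₂ (Equivalence.to T-∧ both)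

  covers-∈ : ∀ {S : List (Fin n × Fin n)} {e v} → e ∈ S → T (touches e v) → T (covers S v)
  covers-∈ e∈S touch = any⁺ _ (Any.map (λ { refl → touch }) e∈S)

  all-bothIn≡all-covered⇒∈ : ∀ (A : Subset n) S →
    all (bothIn A) S ≡ all (λ v → not (covers S v) ∨ lookup A v) (allFin n)
  all-bothIn≡all-covered⇒∈ A S = does-⇔ (mk⇔ to from) (T? _) (T? _)
    where
    to : T (all (bothIn A) S) → T (all (λ v → not (covers S v) ∨ lookup A v) (allFin n))
    to h = all⁻ (λ v → not (covers S v) ∨ lookup A v) {allFin n} (All.tabulate (λ {v} _ → T-not∨⁺ (∈A v)))
      where
      ∈A : ∀ v → T (covers S v) → T (lookup A v)
      ∈A v covered = let both , touch = All.lookupAny (all⁺ (bothIn A) S h) (any⁻ (λ e → touches e v) S covered)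
                     in touches⇒∈ A _ v both touch
    from : T (all (λ v → not (covers S v) ∨ lookup A v) (allFin n)) → T (all (bothIn A) S)
    from h = all⁻ (bothIn A) {S} (All.tabulate (λ {e} e∈S →
      Equivalence.from T-∧ (∈A (covers-∈ e∈S (touches-proj₁ e)) , ∈A (covers-∈ e∈S (touches-proj₂ e)))))
      where
      ∈A : ∀ {v} → T (covers S v) → T (lookup A v)
      ∈A {v} = T-not∨⁻ (All.lookup (all⁺ (λ v → not (covers S v) ∨ lookup A v) (allFin n) h) (∈-allFin v))

open import Data.Rational using (ℚ; 0ℚ; 1ℚ; _+_; _*_)
open import Data.Rational using (_/_; mkℚ; ≢-nonZero)
import Data.Rational.Properties as ℚ
import Data.Integer as ℤ
import Data.Integer.Properties as ℤ
import Data.Nat.Coprimality as Coprimality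
open import Tactic.RingSolver using (solve-∀)
open import Tactic.RingSolver.Core.AlmostCommutativeRing using (AlmostCommutativeRing; fromCommutativeRing)

ℚ-commutativeSemiring : CommutativeSemiring 0ℓ 0ℓ
ℚ-commutativeSemiring = CommutativeRing.commutativeSemiring ℚ.+-*-commutativeRing

open BigOperators ℚ-commutativeSemiring
import Algebra.Properties.Semiring.Exp (CommutativeSemiring.semiring ℚ-commutativeSemiring) as Exp
import Algebra.Properties.Semiring.Mult (CommutativeSemiring.semiring ℚ-commutativeSemiring) as Mult
open CommutativeSemigroupProperties (CommutativeSemiring.*-commutativeSemigroup ℚ-commutativeSemiring)
  using () renaming (interchange to *-interchange)

ℚ-almostCommutativeRing : AlmostCommutativeRing 0ℓ 0ℓ
ℚ-almostCommutativeRing = fromCommutativeRing ℚ.+-*-commutativeRing (λ _ → nothing)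

fromℕ-suc : ∀ m → fromℕ (ℕ.suc m) ≡ 1ℚ + fromℕ m
fromℕ-suc m = begin
  ℤ.+ ℕ.suc m / 1                    ≡⟨ ℚ./-cong (cong (ℤ._+_ (ℤ.+ 1)) (sym (ℤ.*-identityʳ (ℤ.+ m)))) refl ⟩
  (ℤ.+ 1 ℤ.+ ℤ.+ m ℤ.* ℤ.+ 1) / 1    ≡⟨⟩ -- the definition of _+_ on normal forms
  1ℚ + mkℚ (ℤ.+ m) 0 m⊥1             ≡⟨ cong (1ℚ +_) (ℚ.normalize-coprime m⊥1) ⟨
  1ℚ + fromℕ m                       ∎
  where
  open ≡-Reasoning
  m⊥1 : Coprimality.Coprime m 1
  m⊥1 = Coprimality.sym (Coprimality.1-coprimeTo m)

fromℕ≡×1ℚ : ∀ m → fromℕ m ≡ m Mult.× 1ℚ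
fromℕ≡×1ℚ ℕ.zero    = refl
fromℕ≡×1ℚ (ℕ.suc m) = trans (fromℕ-suc m) (cong (1ℚ +_) (fromℕ≡×1ℚ m))

fromℕ-+ : ∀ m n → fromℕ (m ℕ.+ n) ≡ fromℕ m + fromℕ n
fromℕ-+ m n = begin
  fromℕ (m ℕ.+ n)            ≡⟨ fromℕ≡×1ℚ (m ℕ.+ n) ⟩
  (m ℕ.+ n) Mult.× 1ℚ        ≡⟨ Mult.×-homo-+ 1ℚ m n ⟩
  m Mult.× 1ℚ + n Mult.× 1ℚ  ≡⟨ cong₂ _+_ (fromℕ≡×1ℚ m) (fromℕ≡×1ℚ n) ⟨
  fromℕ m + fromℕ n          ∎
  where open ≡-Reasoning

fromℕ-* : ∀ m n → fromℕ (m ℕ.* n) ≡ fromℕ m * fromℕ n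
fromℕ-* m n = begin
  fromℕ (m ℕ.* n)              ≡⟨ fromℕ≡×1ℚ (m ℕ.* n) ⟩
  (m ℕ.* n) Mult.× 1ℚ          ≡⟨ Mult.×1-homo-* m n ⟩
  m Mult.× 1ℚ * n Mult.× 1ℚ    ≡⟨ cong₂ _*_ (fromℕ≡×1ℚ m) (fromℕ≡×1ℚ n) ⟨
  fromℕ m * fromℕ n            ∎
  where open ≡-Reasoning

fromℕ-∑ : ∀ {X : Set} xs (f : X → ℕ) → fromℕ (Sumℕ.∑ xs f) ≡ ∑ xs (fromℕ ∘ f)
fromℕ-∑ []       f = refl
fromℕ-∑ (x ∷ xs) f = trans (fromℕ-+ (f x) _) (cong (fromℕ (f x) +_) (fromℕ-∑ xs f))

fromℕ-𝟙 : ∀ b → fromℕ (Sumℕ.𝟙 b) ≡ 𝟙 b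
fromℕ-𝟙 true  = refl
fromℕ-𝟙 false = refl

fromℕ[C]*≡∑-choose : ∀ {X : Set} (p : X → Bool) k xs c →
  fromℕ (count p xs C k) * c ≡ ∑ (choose k xs) (λ S → 𝟙 (all p S) * c)
fromℕ[C]*≡∑-choose p k xs c = begin
  fromℕ (count p xs C k) * c                                    ≡⟨ cong (λ m → fromℕ m * c) (∑-choose-all p k xs) ⟨
  fromℕ (Sumℕ.∑ (choose k xs) (Sumℕ.𝟙 ∘ all p)) * c             ≡⟨ cong (_* c) (fromℕ-∑ (choose k xs) (Sumℕ.𝟙 ∘ all p)) ⟩
  ∑ (choose k xs) (λ S → fromℕ (Sumℕ.𝟙 (all p S))) * c          ≡⟨ *-distribʳ-∑ c (choose k xs) _ ⟩
  ∑ (choose k xs) (λ S → fromℕ (Sumℕ.𝟙 (all p S)) * c)          ≡⟨ ∑-cong (choose k xs) (λ S → cong (_* c) (fromℕ-𝟙 (all p S))) ⟩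
  ∑ (choose k xs) (λ S → 𝟙 (all p S) * c)                       ∎
  where open ≡-Reasoning

fromℕ≢0 : ∀ m .{{_ : ℕ.NonZero m}} → fromℕ m ≢ 0ℚ
fromℕ≢0 m m≡0 = ℚ.<⇒≢ (ℚ.positive⁻¹ (fromℕ m) {{ℚ.normalize-pos m 1}}) (sym m≡0)

^≡Exp^ : ∀ p k → p ^ k ≡ p Exp.^ k
^≡Exp^ p ℕ.zero    = refl
^≡Exp^ p (ℕ.suc k) = cong (p *_) (^≡Exp^ p k)

^-+ : ∀ p m n → p ^ (m ℕ.+ n) ≡ p ^ m * p ^ n
^-+ p m n = begin
  p ^ (m ℕ.+ n)         ≡⟨ ^≡Exp^ p (m ℕ.+ n) ⟩
  p Exp.^ (m ℕ.+ n)     ≡⟨ Exp.^-homo-* p m n ⟩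
  p Exp.^ m * p Exp.^ n ≡⟨ cong₂ _*_ (^≡Exp^ p m) (^≡Exp^ p n) ⟨
  p ^ m * p ^ n         ∎
  where open ≡-Reasoning

^-* : ∀ p m n → (p ^ m) ^ n ≡ p ^ (m ℕ.* n)
^-* p m n = begin
  (p ^ m) ^ n           ≡⟨ trans (^≡Exp^ (p ^ m) n) (cong (Exp._^ n) (^≡Exp^ p m)) ⟩
  (p Exp.^ m) Exp.^ n   ≡⟨ Exp.^-assocʳ p m n ⟩
  p Exp.^ (m ℕ.* n)     ≡⟨ ^≡Exp^ p (m ℕ.* n) ⟨
  p ^ (m ℕ.* n)         ∎
  where open ≡-Reasoning

inv-inverseʳ : ∀ p → p ≢ 0ℚ → p * inv p ≡ 1ℚ
inv-inverseʳ p p≢0 with p ℚ.≟ 0ℚ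
... | yes p≡0 = ⊥-elim (p≢0 p≡0)
... | no  _   = ℚ.*-inverseʳ p {{≢-nonZero p≢0}}

*-inv-cancel : ∀ b p q → q ≢ 0ℚ → (if b then p * inv q else 1ℚ) * q ≡ (if b then p else q)
*-inv-cancel true  p q q≢0 = begin
  p * inv q * q    ≡⟨ ℚ.*-assoc p (inv q) q ⟩
  p * (inv q * q)  ≡⟨ cong (p *_) (trans (ℚ.*-comm (inv q) q) (inv-inverseʳ q q≢0)) ⟩
  p * 1ℚ           ≡⟨ ℚ.*-identityʳ p ⟩
  p                ∎
  where open ≡-Reasoning
*-inv-cancel false p q q≢0 = ℚ.*-identityˡ q

*-≢0 : ∀ p q → p ≢ 0ℚ → q ≢ 0ℚ → p * q ≢ 0ℚ
*-≢0 p q p≢0 q≢0 pq≡0 = p≢0 (begin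
  p                ≡⟨ ℚ.*-identityʳ p ⟨
  p * 1ℚ           ≡⟨ cong (p *_) (inv-inverseʳ q q≢0) ⟨
  p * (q * inv q)  ≡⟨ ℚ.*-assoc p q (inv q) ⟨
  p * q * inv q    ≡⟨ cong (_* inv q) pq≡0 ⟩
  0ℚ * inv q       ≡⟨ ℚ.*-zeroˡ (inv q) ⟩
  0ℚ               ∎)
  where open ≡-Reasoning

∏-≢0 : ∀ {X : Set} xs (f : X → ℚ) → (∀ x → f x ≢ 0ℚ) → ∏ xs f ≢ 0ℚ
∏-≢0 []       f f≢0 ()
∏-≢0 (x ∷ xs) f f≢0 = *-≢0 (f x) _ (f≢0 x) (∏-≢0 xs f f≢0)

-- The polynomial G_T at z = y²

-- evalPoly and ∂z are by definition the termwise maps of evalMono and ∂z-mono.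
evalMono : Monomial → ℚ → ℚ → ℚ → ℚ
evalMono (mono c a b e) x y z = fromℕ c * x ^ a * y ^ b * z ^ e

∂z-mono : Monomial → Monomial
∂z-mono (mono c a b e) = mono (c ℕ.* e) a b (e ℕ.∸ 1)

∂z^-mono : ℕ → Monomial → Monomial
∂z^-mono k (mono c a b e) = mono (c ℕ.* (e P′ k)) a b (e ℕ.∸ k)

∂z^-termwise : ∀ k P → ∂z^ k P ≡ map (∂z^-mono k) P
∂z^-termwise ℕ.zero    P = sym (trans (map-cong (λ m → cong (λ c → mono c _ _ _) (ℕ.*-identityʳ _)) P) (map-id P))
∂z^-termwise (ℕ.suc k) P = begin
  map ∂z-mono (∂z^ k P)               ≡⟨ cong (map ∂z-mono) (∂z^-termwise k P) ⟩
  map ∂z-mono (map (∂z^-mono k) P)    ≡⟨ map-∘ P ⟨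
  map (∂z-mono ∘ ∂z^-mono k) P        ≡⟨ map-cong ∂z∘∂z^-mono P ⟩
  map (∂z^-mono (ℕ.suc k)) P          ∎
  where
  open ≡-Reasoning
  ∂z∘∂z^-mono : ∀ m → ∂z-mono (∂z^-mono k m) ≡ ∂z^-mono (ℕ.suc k) m
  ∂z∘∂z^-mono (mono c a b e) = cong₂ (λ c e → mono c a b e)
    (trans (ℕ.*-assoc c (e P′ k) _) (cong (c ℕ.*_) (ℕ.*-comm (e P′ k) _)))
    (trans (ℕ.∸-+-assoc e k 1) (cong (e ℕ.∸_) (ℕ.+-comm k 1)))

C-absorbs : ∀ e k u z → fromℕ (e C k) * (u * z ^ (k ℕ.+ (e ℕ.∸ k))) ≡ fromℕ (e C k) * (u * z ^ e)
C-absorbs e k u z with k ℕ.≤? e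
... | yes k≤e = cong (λ j → fromℕ (e C k) * (u * z ^ j)) (ℕ.m+[n∸m]≡n k≤e)
... | no  k≰e rewrite k>n⇒nCk≡0 (ℕ.≰⇒> k≰e) = trans (ℚ.*-zeroˡ (u * z ^ (k ℕ.+ (e ℕ.∸ k)))) (sym (ℚ.*-zeroˡ (u * z ^ e)))

scaled-∂z^-mono : ∀ k a b e x y →
  y ^ (2 ℕ.* k) * inv (fromℕ (k !)) * evalMono (∂z^-mono k (mono 1 a b e)) x y (y ^ 2)
    ≡ fromℕ (e C k) * (x ^ a * y ^ b * (y ^ 2) ^ e)
scaled-∂z^-mono k a b e x y = begin
  y ^ (2 ℕ.* k) * inv K * (fromℕ (1 ℕ.* (e P′ k)) * X * Y * z ^ (e ℕ.∸ k))
    ≡⟨ cong₂ (λ p q → p * inv K * (q * X * Y * z ^ (e ℕ.∸ k))) (sym (^-* y 2 k)) coefficient ⟩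
  z ^ k * inv K * (N * K * X * Y * z ^ (e ℕ.∸ k))
    ≡⟨ rearrange (z ^ k) (inv K) N K X Y (z ^ (e ℕ.∸ k)) ⟩
  N * (K * inv K) * (X * Y * (z ^ k * z ^ (e ℕ.∸ k)))
    ≡⟨ cong₂ (λ p q → N * p * (X * Y * q)) (inv-inverseʳ K (fromℕ≢0 (k !) {{ℕ._!≢0 k}})) (sym (^-+ z k _)) ⟩
  N * 1ℚ * (X * Y * z ^ (k ℕ.+ (e ℕ.∸ k)))
    ≡⟨ cong (_* (X * Y * z ^ (k ℕ.+ (e ℕ.∸ k)))) (ℚ.*-identityʳ N) ⟩
  N * (X * Y * z ^ (k ℕ.+ (e ℕ.∸ k)))
    ≡⟨ C-absorbs e k (X * Y) z ⟩
  N * (X * Y * z ^ e) ∎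
  where
  open ≡-Reasoning
  z K N X Y : ℚ
  z = y ^ 2
  K = fromℕ (k !)
  N = fromℕ (e C k)
  X = x ^ a
  Y = y ^ b
  coefficient : fromℕ (1 ℕ.* (e P′ k)) ≡ N * K
  coefficient = trans (cong fromℕ (trans (ℕ.*-identityˡ _) (nP′k≡nCk*k! e k))) (fromℕ-* (e C k) (k !))
  rearrange : ∀ p q r s t u v → p * q * (r * s * t * u * v) ≡ r * (s * q) * (t * u * (p * v))
  rearrange = solve-∀ ℚ-almostCommutativeRing

weight-power : ∀ {n} (d : Fin n → ℕ) x y (A : Subset n) →
  weight (λ v → x * y ^ d v) A ≡ x ^ ∣ A ∣ * y ^ Sumℕ.∑ (allFin n) (λ v → d v ℕ.* Sumℕ.𝟙 (lookup A v))
weight-power d x y []      = refl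
weight-power {ℕ.suc n} d x y (b ∷ A) = begin
  weight w (b ∷ A)                                   ≡⟨ ∏-allFin-suc (λ v → if lookup (b ∷ A) v then w v else 1ℚ) ⟩
  (if b then w zero else 1ℚ) * weight (w ∘ suc) A    ≡⟨ cong ((if b then w zero else 1ℚ) *_) (weight-power (d ∘ suc) x y A) ⟩
  (if b then w zero else 1ℚ) * (x ^ ∣ A ∣ * y ^ S)   ≡⟨ split-zero b ⟩
  x ^ ∣ b ∷ A ∣ * y ^ (d zero ℕ.* Sumℕ.𝟙 b ℕ.+ S)    ≡⟨ cong (λ m → x ^ ∣ b ∷ A ∣ * y ^ m) (Sumℕ.∑-allFin-suc E) ⟨
  x ^ ∣ b ∷ A ∣ * y ^ Sumℕ.∑ (allFin _) E            ∎
  where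
  open ≡-Reasoning
  w : Fin (ℕ.suc n) → ℚ
  w v = x * y ^ d v
  E : Fin (ℕ.suc n) → ℕ
  E v = d v ℕ.* Sumℕ.𝟙 (lookup (b ∷ A) v)
  S : ℕ
  S = Sumℕ.∑ (allFin n) (λ v → d (suc v) ℕ.* Sumℕ.𝟙 (lookup A v))
  split-zero : ∀ b → (if b then w zero else 1ℚ) * (x ^ ∣ A ∣ * y ^ S) ≡ x ^ ∣ b ∷ A ∣ * y ^ (d zero ℕ.* Sumℕ.𝟙 b ℕ.+ S)
  split-zero true  = begin
    x * y ^ d zero * (x ^ ∣ A ∣ * y ^ S)     ≡⟨ *-interchange x (y ^ d zero) (x ^ ∣ A ∣) (y ^ S) ⟩
    x * x ^ ∣ A ∣ * (y ^ d zero * y ^ S)     ≡⟨ cong (x * x ^ ∣ A ∣ *_) (^-+ y (d zero) S) ⟨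
    x * x ^ ∣ A ∣ * y ^ (d zero ℕ.+ S)       ≡⟨ cong (λ m → x * x ^ ∣ A ∣ * y ^ (m ℕ.+ S)) (ℕ.*-identityʳ (d zero)) ⟨
    x * x ^ ∣ A ∣ * y ^ (d zero ℕ.* 1 ℕ.+ S) ∎
  split-zero false = trans (ℚ.*-identityˡ _) (cong (λ m → x ^ ∣ A ∣ * y ^ (m ℕ.+ S)) (sym (ℕ.*-zeroʳ (d zero))))

monomial-at-y² : ∀ {n} (G : Graph n) x y A →
  x ^ ∣ A ∣ * y ^ dOut G A * (y ^ 2) ^ eIn G A ≡ weight (λ v → x * y ^ deg G v) A
monomial-at-y² G x y A = begin
  x ^ ∣ A ∣ * y ^ dOut G A * (y ^ 2) ^ eIn G A          ≡⟨ ℚ.*-assoc (x ^ ∣ A ∣) (y ^ dOut G A) ((y ^ 2) ^ eIn G A) ⟩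
  x ^ ∣ A ∣ * (y ^ dOut G A * (y ^ 2) ^ eIn G A)        ≡⟨ cong (λ p → x ^ ∣ A ∣ * (y ^ dOut G A * p)) (^-* y 2 (eIn G A)) ⟩
  x ^ ∣ A ∣ * (y ^ dOut G A * y ^ (2 ℕ.* eIn G A))      ≡⟨ cong (x ^ ∣ A ∣ *_) (^-+ y (dOut G A) (2 ℕ.* eIn G A)) ⟨
  x ^ ∣ A ∣ * y ^ (dOut G A ℕ.+ 2 ℕ.* eIn G A)          ≡⟨ cong (λ m → x ^ ∣ A ∣ * y ^ m) (dOut+2*eIn≡∑deg G A) ⟩
  x ^ ∣ A ∣ * y ^ Sumℕ.∑ (allFin _) (λ v → deg G v ℕ.* Sumℕ.𝟙 (lookup A v))
                                                        ≡⟨ weight-power (deg G) x y A ⟨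
  weight (λ v → x * y ^ deg G v) A                      ∎
  where open ≡-Reasoning

module _ {n : ℕ} (G : Graph n) (x y : ℚ) where

  xy^deg : Fin n → ℚ
  xy^deg v = x * y ^ deg G v

  G-at-y² : evalPoly (GPoly G) x y (y ^ 2) ≡ ∏ (allFin n) (λ v → 1ℚ + xy^deg v)
  G-at-y² = begin
    evalPoly (GPoly G) x y (y ^ 2)
      ≡⟨ ∑-map (λ A → mono 1 ∣ A ∣ (dOut G A) (eIn G A)) (subsets n) (λ m → evalMono m x y (y ^ 2)) ⟩
    ∑ (subsets n) (λ A → 1ℚ * x ^ ∣ A ∣ * y ^ dOut G A * (y ^ 2) ^ eIn G A)
      ≡⟨ ∑-cong (subsets n) (λ A → trans (cong (λ p → p * y ^ dOut G A * (y ^ 2) ^ eIn G A) (ℚ.*-identityˡ (x ^ ∣ A ∣)))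
                                          (monomial-at-y² G x y A)) ⟩
    ∑ (subsets n) (weight xy^deg)
      ≡⟨ ∑-subsets-∏ n (λ v b → if b then xy^deg v else 1ℚ) ⟩
    ∏ (allFin n) (λ v → xy^deg v + 1ℚ)
      ≡⟨ ∏-cong (allFin n) (λ v → ℚ.+-comm (xy^deg v) 1ℚ) ⟩
    ∏ (allFin n) (λ v → 1ℚ + xy^deg v) ∎
    where open ≡-Reasoning

  scaled-∂z^G-at-y² : ∀ k →
    y ^ (2 ℕ.* k) * inv (fromℕ (k !)) * evalPoly (∂z^ k (GPoly G)) x y (y ^ 2)
      ≡ ∑ (choose k (edges G)) (λ S → ∏ (allFin n) (λ v → if covers S v then xy^deg v else 1ℚ + xy^deg v))
  scaled-∂z^G-at-y² k = begin
    c * evalPoly (∂z^ k (GPoly G)) x y (y ^ 2)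
      ≡⟨ cong (λ P → c * evalPoly P x y (y ^ 2)) (∂z^-termwise k (GPoly G)) ⟩
    c * evalPoly (map (∂z^-mono k) (GPoly G)) x y (y ^ 2)
      ≡⟨ cong (c *_) (trans (∑-map (∂z^-mono k) (GPoly G) _) (∑-map monoOf (subsets n) _)) ⟩
    c * ∑ (subsets n) (λ A → evalMono (∂z^-mono k (monoOf A)) x y (y ^ 2))
      ≡⟨ *-distribˡ-∑ c (subsets n) _ ⟩
    ∑ (subsets n) (λ A → c * evalMono (∂z^-mono k (monoOf A)) x y (y ^ 2))
      ≡⟨ ∑-cong (subsets n) (λ A → trans (scaled-∂z^-mono k ∣ A ∣ (dOut G A) (eIn G A) x y)
                                          (cong (fromℕ (eIn G A C k) *_) (monomial-at-y² G x y A))) ⟩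
    ∑ (subsets n) (λ A → fromℕ (eIn G A C k) * weight xy^deg A)
      ≡⟨ ∑-cong (subsets n) (λ A → fromℕ[C]*≡∑-choose (bothIn A) k (edges G) (weight xy^deg A)) ⟩
    ∑ (subsets n) (λ A → ∑ (choose k (edges G)) (λ S → 𝟙 (all (bothIn A) S) * weight xy^deg A))
      ≡⟨ ∑-comm (subsets n) (choose k (edges G)) _ ⟩
    ∑ (choose k (edges G)) (λ S → ∑ (subsets n) (λ A → 𝟙 (all (bothIn A) S) * weight xy^deg A))
      ≡⟨ ∑-cong (choose k (edges G)) (λ S → trans
           (∑-cong (subsets n) (λ A → cong (λ b → 𝟙 b * weight xy^deg A) (all-bothIn≡all-covered⇒∈ A S)))
           (∑-supersets-weight n (covers S) xy^deg)) ⟩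
    ∑ (choose k (edges G)) (λ S → ∏ (allFin n) (λ v → if covers S v then xy^deg v else 1ℚ + xy^deg v)) ∎
    where
    open ≡-Reasoning
    c : ℚ
    c = y ^ (2 ℕ.* k) * inv (fromℕ (k !))
    monoOf : Subset n → Monomial
    monoOf A = mono 1 ∣ A ∣ (dOut G A) (eIn G A)

  Γ*G-at-y² : ∀ k → (∀ v → 1ℚ + xy^deg v ≢ 0ℚ) →
    Γ G k x y * ∏ (allFin n) (λ v → 1ℚ + xy^deg v)
      ≡ ∑ (choose k (edges G)) (λ S → ∏ (allFin n) (λ v → if covers S v then xy^deg v else 1ℚ + xy^deg v))
  Γ*G-at-y² k 1+xy^deg≢0 = begin
    Γ G k x y * P                                       ≡⟨ *-distribʳ-∑ P (choose k (edges G)) _ ⟩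
    ∑ (choose k (edges G)) (λ S → ∏ (coveredBy S) r * P) ≡⟨ ∑-cong (choose k (edges G)) term*P ⟩
    ∑ (choose k (edges G)) (λ S → ∏ (allFin n) (λ v → if covers S v then xy^deg v else 1ℚ + xy^deg v)) ∎
    where
    open ≡-Reasoning
    P : ℚ
    P = ∏ (allFin n) (λ v → 1ℚ + xy^deg v)
    r : Fin n → ℚ
    r v = xy^deg v * inv (1ℚ + xy^deg v)
    term*P : ∀ S → ∏ (coveredBy S) r * P ≡ ∏ (allFin n) (λ v → if covers S v then xy^deg v else 1ℚ + xy^deg v)
    term*P S = begin
      ∏ (coveredBy S) r * P
        ≡⟨ cong (_* P) (∏-filterᵇ (covers S) (allFin n) r) ⟩
      ∏ (allFin n) (λ v → if covers S v then r v else 1ℚ) * P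
        ≡⟨ ∏-distrib-* (allFin n) _ _ ⟩
      ∏ (allFin n) (λ v → (if covers S v then r v else 1ℚ) * (1ℚ + xy^deg v))
        ≡⟨ ∏-cong (allFin n) (λ v → *-inv-cancel (covers S v) (xy^deg v) (1ℚ + xy^deg v) (1+xy^deg≢0 v)) ⟩
      ∏ (allFin n) (λ v → if covers S v then xy^deg v else 1ℚ + xy^deg v) ∎

proposition4p3 : (n : ℕ) (T : Graph n) → IsTree T → (k : ℕ) (x y : ℚ) →
    (∀ (v : Fin n) → 1ℚ + x * y ^ deg T v ≢ 0ℚ) →
    Γ T k x y ≡ (y ^ (2 Data.Nat.* k)) * inv (fromℕ (k !)) * evalPoly (∂z^ k (GPoly T)) x y (y ^ 2) * inv (evalPoly (GPoly T) x y (y ^ 2))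
proposition4p3 n T _ k x y 1+xy^deg≢0 = begin
  Γ T k x y                                                  ≡⟨ ℚ.*-identityʳ (Γ T k x y) ⟨
  Γ T k x y * 1ℚ                                             ≡⟨ cong (Γ T k x y *_) (inv-inverseʳ G G≢0) ⟨
  Γ T k x y * (G * inv G)                                    ≡⟨ ℚ.*-assoc (Γ T k x y) G (inv G) ⟨
  Γ T k x y * G * inv G                                      ≡⟨ cong (λ g → Γ T k x y * g * inv G) (G-at-y² T x y) ⟩
  Γ T k x y * ∏ (allFin n) (λ v → 1ℚ + x * y ^ deg T v) * inv G
    ≡⟨ cong (_* inv G) (trans (Γ*G-at-y² T x y k 1+xy^deg≢0) (sym (scaled-∂z^G-at-y² T x y k))) ⟩
  y ^ (2 ℕ.* k) * inv (fromℕ (k !)) * evalPoly (∂z^ k (GPoly T)) x y (y ^ 2) * inv G ∎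
  where
  open ≡-Reasoning
  G : ℚ
  G = evalPoly (GPoly T) x y (y ^ 2)
  G≢0 : G ≢ 0ℚ
  G≢0 = subst (_≢ 0ℚ) (sym (G-at-y² T x y)) (∏-≢0 (allFin n) _ 1+xy^deg≢0)
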